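{- Let $X,Y,Z$ be finite simple graphs, and let the cells, the minimum dominating set $D$ of $X\square Y\square Z$, and the cell coloring be as described in the context. Then \[ b'+g'+y'+o'+r'+m'\geq \gamma (X) \gamma (Y) |V(Z)|. \]
   Context: Graphs are finite and simple; $\gamma(G)$ is the domination number; $X\square Y$ is the Cartesian product (vertex set $V(X)\times V(Y)$, $(x_1,y_1)\sim(x_2,y_2)$ iff $x_1=x_2$ and $y_1y_2\in E(Y)$, or $y_1=y_2$ and $x_1x_2\in E(X)$). Let $k=\gamma(X)$, let $\{u_1,\dots,u_k\}$ be a minimum dominating set of $X$, and let $\{\pi_1,\dots,\pi_k\}$ be a partition of $V(X)$ with $u_i\in\pi_i\subseteq N[u_i]$ for each $i$, where $N[x]$ is the closed neighborhood of $x$ in $X$. For $i\in\{1,\dots,k\}$, $y\in V(Y)$, $z\in V(Z)$, the cell $\pi_i^{y,z}=\{(a,y,z): a\in\pi_i\}\subseteq V(X\square Y\square Z)$; the cells partition $V(X\square Y\square Z)$. Let $D$ be a minimum dominating set of $X\square Y\square Z$. A vertex $(a,b,c)$ is $X$-dominated if some $(a',b,c)\in D$ with $a'=a$ or $a'a\in E(X)$; $Y$-dominated if some $(a,b',c)\in D$ with $b'b\in E(Y)$; $Z$-dominated if some $(a,b,c')\in D$ with $c'c\in E(Z)$. Cells containing a vertex of $D$ are colored: blue if no vertex of the cell is $Y$-dominated or $Z$-dominated; otherwise green if no vertex is $Z$-dominated; otherwise yellow if no vertex is $Y$-dominated; otherwise orange. Cells containing no vertex of $D$ are colored: red if no vertex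 is $Y$-dominated or $Z$-dominated; otherwise pink if no vertex is $Z$-dominated; otherwise maroon if no vertex is $Y$-dominated; otherwise white. Let $b',g',y',o',r',p',m',w'$ be the total numbers of blue, green, yellow, orange, red, pink, maroon, white cells respectively. -}

module Defs where

open import Data.Nat using (ℕ; zero; suc; _+_; _*_; _≤_; _≡ᵇ_)
open import Data.Fin using (Fin; zero; suc; _≟_)
open import Data.Bool using (Bool; true; false; _∧_; _∨_; not; if_then_else_)
open import Data.Product using (Σ; _×_; _,_)
open import Data.Sum using (_⊎_)
open import Relation.Nullary.Decidable using (⌊_⌋)
open import Relation.Binary.PropositionalEquality using (_≡_)

record Graph : Set where
  field
    n      : ℕ
    adj    : Fin n → Fin n → Bool
    sym    : ∀ x y → adj x y ≡ adj y x
    irrefl : ∀ x → adj x x ≡ false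
open Graph public

sumFin : (n : ℕ) → (Fin n → ℕ) → ℕ
sumFin zero    f = 0
sumFin (suc n) f = f zero + sumFin n (λ i → f (suc i))

anyFin : (n : ℕ) → (Fin n → Bool) → Bool
anyFin zero    f = false
anyFin (suc n) f = f zero ∨ anyFin n (λ i → f (suc i))

ind : Bool → ℕ
ind true  = 1
ind false = 0

Dominating : {V : Set} → (V → V → Bool) → (V → Bool) → Set
Dominating {V} adj S = ∀ v → S v ≡ true ⊎ Σ V (λ u → S u ≡ true × adj u v ≡ true)

size : (G : Graph) → (Fin (n G) → Bool) → ℕ
size G S = sumFin (n G) (λ v → ind (S v))

IsDomNum : Graph → ℕ → Set
IsDomNum G k =
  Σ (Fin (n G) → Bool) (λ S → Dominating (adj G) S × size G S ≡ k)
  × (∀ S → Dominating (adj G) S → k ≤ size G S)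

module Triple (X Y Z : Graph) where
  V3 : Set
  V3 = Fin (n X) × Fin (n Y) × Fin (n Z)

  adj3 : V3 → V3 → Bool
  adj3 (a , b , c) (a' , b' , c') =
       (adj X a a' ∧ ⌊ b ≟ b' ⌋ ∧ ⌊ c ≟ c' ⌋)
    ∨ (⌊ a ≟ a' ⌋ ∧ adj Y b b' ∧ ⌊ c ≟ c' ⌋)
    ∨ (⌊ a ≟ a' ⌋ ∧ ⌊ b ≟ b' ⌋ ∧ adj Z c c')

  size3 : (V3 → Bool) → ℕ
  size3 D = sumFin (n X) λ a → sumFin (n Y) λ b → sumFin (n Z) λ c → ind (D (a , b , c))

  IsMinDom3 : (V3 → Bool) → Set
  IsMinDom3 D = Dominating adj3 D × (∀ D' → Dominating adj3 D' → size3 D ≤ size3 D')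

data Color : Set where
  blue green yellow orange red pink maroon white : Color

code : Color → ℕ
code blue = 0
code green = 1
code yellow = 2
code orange = 3
code red = 4
code pink = 5
code maroon = 6
code white = 7

module Cells (X Y Z : Graph) (k : ℕ) (π : Fin (n X) → Fin k)
             (D : Triple.V3 X Y Z → Bool) where

  Ydom : Fin (n X) → Fin (n Y) → Fin (n Z) → Bool
  Ydom a b c = anyFin (n Y) (λ b' → adj Y b' b ∧ D (a , b' , c))

  Zdom : Fin (n X) → Fin (n Y) → Fin (n Z) → Bool
  Zdom a b c = anyFin (n Z) (λ c' → adj Z c' c ∧ D (a , b , c'))

  -- properties of the cell π_i^{y,z} = {(a,y,z) : a ∈ π_i}
  hasD someY someZ : Fin k → Fin (n Y) → Fin (n Z) → Bool
  hasD  i y z = anyFin (n X) (λ a → ⌊ π a ≟ i ⌋ ∧ D (a , y , z))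
  someY i y z = anyFin (n X) (λ a → ⌊ π a ≟ i ⌋ ∧ Ydom a y z)
  someZ i y z = anyFin (n X) (λ a → ⌊ π a ≟ i ⌋ ∧ Zdom a y z)

  color : Fin k → Fin (n Y) → Fin (n Z) → Color
  color i y z =
    if hasD i y z
    then (if not (someY i y z) ∧ not (someZ i y z) then blue
          else if not (someZ i y z) then green
          else if not (someY i y z) then yellow
          else orange)
    else (if not (someY i y z) ∧ not (someZ i y z) then red
          else if not (someZ i y z) then pink
          else if not (someY i y z) then maroon
          else white)

  count : Color → ℕ
  count col = sumFin k λ i → sumFin (n Y) λ y → sumFin (n Z) λ z →
              ind (code (color i y z) ≡ᵇ code col)

-- Fix a class i of the partition and a layer z. Call y selected when the cell
-- π_i^{y,z} is neither pink nor white, i.e. it meets D or has no Y-dominated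
-- vertex. The selected y dominate Y: a Y-dominated vertex (a,y,z) of a cell
-- without D has a neighbour (a,y',z) ∈ D, and then π_i^{y',z} meets D. Hence at
-- least γ(Y) cells of every such row are among the six colours, and summing over
-- the k·|V(Z)| rows gives the bound.
module Submission where

open import Defs hiding (sym)
open import Data.Nat using (ℕ; zero; suc; _+_; _*_; _≤_; _≥_; z≤n; _≡ᵇ_)
open import Data.Nat.Properties using (+-mono-≤; *-assoc; *-comm; +-0-commutativeMonoid; module ≤-Reasoning)
open import Data.Fin using (Fin; zero; suc)
open import Data.Bool using (Bool; true; false; _∧_; _∨_; not)
open import Data.Bool.Properties using (∨-zeroʳ)
open import Data.Sum using (_⊎_; inj₁; inj₂)
open import Data.Product using (Σ; _×_; _,_)
open import Relation.Binary.PropositionalEquality using (_≡_; refl; sym; trans; cong; cong₂; module ≡-Reasoning)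
open import Algebra.Properties.CommutativeMonoid.Sum +-0-commutativeMonoid using (sum; ∑-distrib-+; ∑-comm)

sumFin≡sum : ∀ n (f : Fin n → ℕ) → sumFin n f ≡ sum f
sumFin≡sum zero    f = refl
sumFin≡sum (suc n) f = cong (f zero +_) (sumFin≡sum n (λ i → f (suc i)))

sumFin-cong : ∀ n {f g : Fin n → ℕ} → (∀ i → f i ≡ g i) → sumFin n f ≡ sumFin n g
sumFin-cong zero    f≗g = refl
sumFin-cong (suc n) f≗g = cong₂ _+_ (f≗g zero) (sumFin-cong n (λ i → f≗g (suc i)))

*-≤-sumFin : ∀ n {m} {f : Fin n → ℕ} → (∀ i → m ≤ f i) → n * m ≤ sumFin n f
*-≤-sumFin zero    m≤f = z≤n
*-≤-sumFin (suc n) m≤f = +-mono-≤ (m≤f zero) (*-≤-sumFin n (λ i → m≤f (suc i)))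

sumFin-distrib-+ : ∀ n (f g : Fin n → ℕ) →
                   sumFin n (λ i → f i + g i) ≡ sumFin n f + sumFin n g
sumFin-distrib-+ n f g = begin
  sumFin n (λ i → f i + g i)  ≡⟨ sumFin≡sum n _ ⟩
  sum (λ i → f i + g i)       ≡⟨ ∑-distrib-+ f g ⟩
  sum f + sum g               ≡⟨ sym (cong₂ _+_ (sumFin≡sum n f) (sumFin≡sum n g)) ⟩
  sumFin n f + sumFin n g     ∎
  where open ≡-Reasoning

sumFin-comm : ∀ m n (f : Fin m → Fin n → ℕ) →
              sumFin m (λ i → sumFin n (f i)) ≡ sumFin n (λ j → sumFin m (λ i → f i j))
sumFin-comm m n f = begin
  sumFin m (λ i → sumFin n (f i))          ≡⟨ sumFin-cong m (λ i → sumFin≡sum n (f i)) ⟩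
  sumFin m (λ i → sum (f i))               ≡⟨ sumFin≡sum m _ ⟩
  sum (λ i → sum (f i))                    ≡⟨ ∑-comm f ⟩
  sum (λ j → sum (λ i → f i j))            ≡⟨ sym (sumFin≡sum n _) ⟩
  sumFin n (λ j → sum (λ i → f i j))       ≡⟨ sumFin-cong n (λ j → sym (sumFin≡sum m _)) ⟩
  sumFin n (λ j → sumFin m (λ i → f i j))  ∎
  where open ≡-Reasoning

anyFin-witness : ∀ n (f : Fin n → Bool) → anyFin n f ≡ true → Σ (Fin n) (λ i → f i ≡ true)
anyFin-witness (suc n) f any with f zero in f0
... | true  = zero , f0
... | false with anyFin-witness n (λ i → f (suc i)) any
...   | i , fi = suc i , fi

anyFin-intro : ∀ n (f : Fin n → Bool) i → f i ≡ true → anyFin n f ≡ true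
anyFin-intro (suc n) f zero    fi rewrite fi = refl
anyFin-intro (suc n) f (suc i) fi
  rewrite anyFin-intro n (λ j → f (suc j)) i fi = ∨-zeroʳ (f zero)

∧-true-split : ∀ {a b} → a ∧ b ≡ true → a ≡ true × b ≡ true
∧-true-split {true} {true} _ = refl , refl

∧-true-intro : ∀ {a b} → a ≡ true → b ≡ true → a ∧ b ≡ true
∧-true-intro refl refl = refl

[_≟ᶜ_] : Color → Color → ℕ
[ c ≟ᶜ d ] = ind (code c ≡ᵇ code d)

notPinkOrWhite : Color → ℕ
notPinkOrWhite c = [ c ≟ᶜ blue ] + [ c ≟ᶜ green ] + [ c ≟ᶜ yellow ]
                 + [ c ≟ᶜ orange ] + [ c ≟ᶜ red ] + [ c ≟ᶜ maroon ]

module CellRows (X Y Z : Graph) (k : ℕ) (π : Fin (n X) → Fin k) (D : Triple.V3 X Y Z → Bool) where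
  open Cells X Y Z k π D

  sumCells : (Fin k → Fin (n Y) → Fin (n Z) → ℕ) → ℕ
  sumCells f = sumFin k λ i → sumFin (n Y) λ y → sumFin (n Z) λ z → f i y z

  sumCells-distrib-+ : ∀ f g → sumCells (λ i y z → f i y z + g i y z) ≡ sumCells f + sumCells g
  sumCells-distrib-+ f g =
    trans (sumFin-cong k λ i → trans (sumFin-cong (n Y) λ y → sumFin-distrib-+ (n Z) _ _)
                                     (sumFin-distrib-+ (n Y) _ _))
          (sumFin-distrib-+ k _ _)

  rowSelection : Fin k → Fin (n Z) → Fin (n Y) → Bool
  rowSelection i z y = hasD i y z ∨ not (someY i y z)

  rowSelection-dominating : ∀ i z → Dominating (adj Y) (rowSelection i z)
  rowSelection-dominating i z y with hasD i y z | someY i y z in someY≡true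
  ... | true  | _     = inj₁ refl
  ... | false | false = inj₁ refl
  ... | false | true
    with a , πa≡i∧Ydom ← anyFin-witness (n X) _ someY≡true
    with πa≡i , Ydom ← ∧-true-split πa≡i∧Ydom
    with y' , y'y∧D ← anyFin-witness (n Y) _ Ydom
    with y'y , D[a,y',z] ← ∧-true-split y'y∧D
    = inj₂ (y' , cong (_∨ not (someY i y' z)) hasD[i,y',z] , y'y)
    where
    hasD[i,y',z] : hasD i y' z ≡ true
    hasD[i,y',z] = anyFin-intro (n X) _ a (∧-true-intro πa≡i D[a,y',z])

  notPinkOrWhite-color : ∀ i y z → notPinkOrWhite (color i y z) ≡ ind (rowSelection i z y)
  notPinkOrWhite-color i y z with hasD i y z | someY i y z | someZ i y z
  ... | true  | true  | true  = refl
  ... | true  | true  | false = refl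
  ... | true  | false | true  = refl
  ... | true  | false | false = refl
  ... | false | true  | true  = refl
  ... | false | true  | false = refl
  ... | false | false | true  = refl
  ... | false | false | false = refl

  count-notPinkOrWhite :
    count blue + count green + count yellow + count orange + count red + count maroon
      ≡ sumCells (λ i y z → ind (rowSelection i z y))
  count-notPinkOrWhite = sym (begin
    sumCells (λ i y z → ind (rowSelection i z y))
      ≡⟨ sumFin-cong k (λ i → sumFin-cong (n Y) λ y → sumFin-cong (n Z) λ z →
           sym (notPinkOrWhite-color i y z)) ⟩
    sumCells (λ i y z → notPinkOrWhite (color i y z))
      ≡⟨ sumCells-distrib-+ _ _ ⟩
    sumCells _ + count maroon
      ≡⟨ cong (_+ count maroon) (sumCells-distrib-+ _ _) ⟩
    sumCells _ + count red + count maroon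
      ≡⟨ cong (λ s → s + count red + count maroon) (sumCells-distrib-+ _ _) ⟩
    sumCells _ + count orange + count red + count maroon
      ≡⟨ cong (λ s → s + count orange + count red + count maroon)
           (trans (sumCells-distrib-+ _ _) (cong (_+ count yellow) (sumCells-distrib-+ _ _))) ⟩
    count blue + count green + count yellow + count orange + count red + count maroon ∎)
    where open ≡-Reasoning

lemma1 : (X Y Z : Graph) (k : ℕ) (u : Fin k → Fin (n X)) (π : Fin (n X) → Fin k)
    → IsDomNum X k
    → (∀ a → Σ (Fin k) (λ i → a ≡ u i ⊎ adj X (u i) a ≡ true))
    → (∀ i → π (u i) ≡ i)
    → (∀ a → a ≡ u (π a) ⊎ adj X (u (π a)) a ≡ true)
    → (D : Triple.V3 X Y Z → Bool) → Triple.IsMinDom3 X Y Z D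
    → (γY : ℕ) → IsDomNum Y γY
    → let open Cells X Y Z k π D in
      count blue + count green + count yellow + count orange + count red + count maroon
        ≥ k * γY * n Z
lemma1 X Y Z k _ π _ _ _ _ D _ γY (_ , γY-minimum) = begin
  k * γY * n Z
    ≡⟨ trans (*-assoc k γY (n Z)) (cong (k *_) (*-comm γY (n Z))) ⟩
  k * (n Z * γY)
    ≤⟨ *-≤-sumFin k (λ i → *-≤-sumFin (n Z) λ z →
         γY-minimum (rowSelection i z) (rowSelection-dominating i z)) ⟩
  sumFin k (λ i → sumFin (n Z) λ z → size Y (rowSelection i z))
    ≡⟨ sumFin-cong k (λ i → sumFin-comm (n Z) (n Y) _) ⟩
  sumCells (λ i y z → ind (rowSelection i z y))
    ≡⟨ sym count-notPinkOrWhite ⟩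
  count blue + count green + count yellow + count orange + count red + count maroon ∎
  where
  open Cells X Y Z k π D
  open CellRows X Y Z k π D
  open ≤-Reasoning
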